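{- For every positive integer $j$, the $j$-th pioneer equals $t_{j+1}t_{j+2}$, and it is the smallest element of the $(j+1)^2$-th flock. Furthermore, an almost-square $n>1$ satisfies $F(n)=F(n')$, where $n'$ is the largest almost-square less than $n$, if and only if $n$ is the $j$-th pioneer for some even $j$.
   Context: For a positive integer $n$, let $s(n)=\min_{d\mid n}(d+n/d)$ and $F(n)=n/s(n)$. A positive integer $n$ is an almost-square if $F(k)\le F(n)$ for all positive integers $k\le n$. For a positive integer $k$, the $k$-th flock is the set of almost-squares $n$ with $s(n)=k$ (so the 1st flock is empty, the 2nd is $\{1\}$, the 3rd is $\{2\}$, the 4th is $\{3,4\}$). A pioneer is the smallest element of the $k$-th flock, for some $k\ge4$, such that the $k$-th flock has more elements than the $(k-2)$-th flock; pioneers are numbered $1,2,3,\dots$ in increasing order (the first few are $3, 18, 60, 150$). The triangular numbers are $t_i=i(i-1)/2$ for $i\ge1$. -}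

module Defs where

open import Data.Nat using (ℕ; zero; suc; _+_; _*_; _∸_; _≤_; _<_; _⊓_; _/_; _≤?_; _≟_)
open import Data.Nat.Divisibility using (_∣?_)
open import Data.List using (List; foldr; map; filter; upTo; length)
open import Data.Fin using (Fin; toℕ) renaming (_<_ to _<ᶠ_)
open import Data.Fin.Properties using (all?)
open import Data.Product using (Σ; ∃; _×_; _,_)
open import Relation.Nullary using (Dec)
open import Relation.Nullary.Decidable using (_×-dec_)
open import Relation.Binary.PropositionalEquality using (_≡_)

-- s(n) = min over divisors d of n (1 ≤ d ≤ n) of d + n/d.
-- (Only meaningful for n ≥ 1; the start value suc n equals the d = 1 term.)
s : ℕ → ℕ
s n = foldr _⊓_ (suc n)
        (map (λ i → suc i + n / suc i) (filter (λ i → suc i ∣? n) (upTo n)))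

-- F(k) ≤ F(n), i.e. k / s(k) ≤ n / s(n), cleared of denominators (s > 0).
F≤ : ℕ → ℕ → Set
F≤ k n = k * s n ≤ n * s k

F≡ : ℕ → ℕ → Set
F≡ m n = m * s n ≡ n * s m

-- n is an almost-square: n ≥ 1 and F(k) ≤ F(n) for all 1 ≤ k ≤ n
-- (k = suc (toℕ i) for i : Fin n ranges over 1..n).
AlmostSquare : ℕ → Set
AlmostSquare n = (1 ≤ n) × ((i : Fin n) → F≤ (suc (toℕ i)) n)

almostSquare? : (n : ℕ) → Dec (AlmostSquare n)
almostSquare? n = (1 ≤? n) ×-dec all? (λ i → (suc (toℕ i) * s n) ≤? (n * s (suc (toℕ i))))

InFlock : ℕ → ℕ → Set
InFlock k n = AlmostSquare n × (s n ≡ k)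

inFlock? : (k n : ℕ) → Dec (InFlock k n)
inFlock? k n = almostSquare? n ×-dec (s n ≟ k)

-- number of elements of the k-th flock.  Every n ≥ 1 with s(n) = k satisfies
-- n ≤ k*k (since s(n)² ≥ 4n), so it suffices to count over 0..k*k.
flockSize : ℕ → ℕ
flockSize k = length (filter (inFlock? k) (upTo (suc (k * k))))

MinOfFlock : ℕ → ℕ → Set
MinOfFlock k n = InFlock k n × (∀ m → InFlock k m → n ≤ m)

IsPioneer : ℕ → Set
IsPioneer n = ∃ λ k → (4 ≤ k) × MinOfFlock k n × (flockSize (k ∸ 2) < flockSize k)

JthPioneer : ℕ → ℕ → Set
JthPioneer j n =
  IsPioneer n ×
  Σ (Fin j → ℕ) λ f →
    (∀ a b → a <ᶠ b → f a < f b) ×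
    (∀ a → IsPioneer (f a)) ×
    (∀ a → f a ≤ n) ×
    (∀ m → IsPioneer m → m ≤ n → ∃ λ a → f a ≡ m)

t : ℕ → ℕ
t i = (i * (i ∸ 1)) / 2

LargestASBelow : ℕ → ℕ → Set
LargestASBelow n m = AlmostSquare m × (m < n) × (∀ k → AlmostSquare k → k < n → k ≤ m)

-- Write quarterSquare k = ⌊k²/4⌋; it is the largest n with s n ≤ k, and s (quarterSquare k) ≡ k.
-- An n with s n ≡ k is an almost-square exactly when F n ≥ F (quarterSquare (k − 1)): this
-- suffices because quarterSquare k / k is nondecreasing, and it is necessary because an
-- almost-square never lies at or below quarterSquare (k − 1).  Writing n = a b with a + b = k
-- makes the k-th flock explicit: for k = 2h + 1 it is {h(h+1) − i(i+1) : 2i(i+1) ≤ h}, for k = 2h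
-- it is {h² − i² : 2i² ≤ h}.  Passing from flock k − 2 to flock k raises the bound on i by one,
-- so flock k is larger exactly when a new index with 2i(i+1) = h, resp. 2i² = h, appears, i.e.
-- when k = (j+1)²; the new index yields the smallest element, t(j+1) t(j+2).  An almost-square
-- n > 1 can tie with its predecessor n′ only if n′ = quarterSquare (s n − 1) and the inequality
-- above is an equality, which happens exactly at these smallest elements of odd flocks, i.e. for
-- even j.

module Submission where

open import Defs
open import Data.Nat using (ℕ; zero; suc; _+_; _*_; _∸_; _≤_; _≰_; _<_; _≮_; _≤′_; ≤′-refl; ≤′-step; _≤?_; _<?_; _≟_; _⊓_; _/_; z≤n; s≤s; >-nonZero; ⌊_/2⌋)
open import Data.Nat.Properties
open import Data.Nat.Divisibility using (_∣_; divides; _∣?_; ∣m+n∣m⇒∣n; ∣1⇒≡1; m∣m*n)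
open import Data.Nat.DivMod using (m*n/n≡m; m*[n/m]≡n)
open import Data.Nat.Tactic.RingSolver using (solve-∀)
open import Data.List using (List; []; _∷_; foldr; map; filter; upTo; length)
open import Data.List.Properties using (foldr-preservesᵒ; length-map)
open import Data.List.Membership.Propositional using (_∈_)
open import Data.List.Membership.Propositional.Properties using (foldr-selective; ∈-map⁺; ∈-map⁻; ∈-filter⁺; ∈-filter⁻; ∈-upTo⁺; ∈-upTo⁻)
open import Data.List.Membership.Propositional.Properties.WithK using (unique∧set⇒bag)
open import Data.List.Relation.Unary.Any using (here; there)
import Data.List.Relation.Unary.Any as Any
import Data.List.Relation.Unary.All as All
import Data.List.Relation.Unary.All.Properties as All
open import Data.List.Relation.Unary.Unique.Propositional using (Unique; []; _∷_)
import Data.List.Relation.Unary.Unique.Propositional.Properties as Unique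
open import Data.List.Relation.Binary.BagAndSetEquality using (∼bag⇒↭)
open import Data.List.Relation.Binary.Permutation.Propositional.Properties using (↭-length)
open import Data.Fin using (Fin; toℕ; fromℕ<)
open import Data.Fin.Properties using (toℕ-fromℕ<; toℕ<n; cantor-schröder-bernstein) renaming (<-cmp to <ᶠ-cmp)
open import Data.Product using (Σ; ∃; ∃₂; _×_; _,_; proj₁; proj₂)
open import Data.Sum using (_⊎_; inj₁; inj₂; [_,_])
open import Data.Empty using (⊥-elim)
open import Function.Base using (_∘_)
open import Function.Bundles using (_⇔_; mk⇔; Equivalence)
open import Function.Construct.Composition using (_⇔-∘_)
open import Function.Definitions using (Injective)
open import Relation.Nullary using (¬_; yes; no; contradiction)
open import Relation.Unary using (Decidable)
open import Relation.Binary.Definitions using (Trichotomous; tri<; tri≈; tri>)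
open import Relation.Binary.PropositionalEquality hiding ([_])

-- The function s and quarter-squares

m+o≡n⇒m≤n : ∀ {m n} o → m + o ≡ n → m ≤ n
m+o≡n⇒m≤n {m} o refl = m≤m+n m o

foldr-⊓-≤ : ∀ z {xs : List ℕ} {x} → x ∈ xs → foldr _⊓_ z xs ≤ x
foldr-⊓-≤ z {xs} x∈xs =
  foldr-preservesᵒ (λ a b → [ m≤n⇒m⊓o≤n b , m≤n⇒o⊓m≤n a ]) z xs
    (inj₂ (Any.map (λ { refl → ≤-refl }) x∈xs))

s[*]≤+ : ∀ {a b} → 1 ≤ a → 1 ≤ b → s (a * b) ≤ a + b
s[*]≤+ {suc a} {suc b} _ _ = begin
  s n                     ≤⟨ foldr-⊓-≤ (suc n) (∈-map⁺ _ (∈-filter⁺ (λ i → suc i ∣? n) a<n a+1∣n)) ⟩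
  suc a + n / suc a       ≡⟨ cong (suc a +_) (trans (cong (_/ suc a) (*-comm (suc a) (suc b))) (m*n/n≡m (suc b) (suc a))) ⟩
  suc a + suc b           ∎
  where
  open ≤-Reasoning
  n = suc a * suc b
  a<n : a ∈ upTo n
  a<n = ∈-upTo⁺ (s≤s (≤-trans (m≤m*n a (suc b)) (m≤n+m (a * suc b) b)))
  a+1∣n : suc a ∣ n
  a+1∣n = divides (suc b) (*-comm (suc a) (suc b))

s-attained : ∀ n → ∃₂ λ a b → a * b ≡ n × s n ≡ a + b
s-attained n with foldr-selective ⊓-sel (suc n) (map value (filter (λ i → suc i ∣? n) (upTo n)))
  where
  value : ℕ → ℕ
  value i = suc i + n / suc i
... | inj₁ s≡1+n = 1 , n , +-identityʳ n , s≡1+n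
... | inj₂ s∈values with ∈-map⁻ _ s∈values
...   | i , i∈divisors , s≡value with ∈-filter⁻ (λ i → suc i ∣? n) {xs = upTo n} i∈divisors
...     | _ , i+1∣n = suc i , n / suc i , m*[n/m]≡n i+1∣n , s≡value

1≤*⇒1≤ : ∀ {a b} → 1 ≤ a * b → 1 ≤ a × 1 ≤ b
1≤*⇒1≤ {suc a} {suc b} _ = s≤s z≤n , s≤s z≤n
1≤*⇒1≤ {suc a} {zero} 1≤a*0 = contradiction (subst (1 ≤_) (*-zeroʳ a) 1≤a*0) λ ()

s≥2 : ∀ {n} → 1 ≤ n → 2 ≤ s n
s≥2 {n} 1≤n with s-attained n
... | a , b , refl , s≡a+b with 1≤*⇒1≤ {a} {b} 1≤n
...   | 1≤a , 1≤b = subst (2 ≤_) (sym s≡a+b) (+-mono-≤ 1≤a 1≤b)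

quarterSquare : ℕ → ℕ
quarterSquare 0 = 0
quarterSquare 1 = 0
quarterSquare (suc (suc k)) = quarterSquare k + suc k

data Parity : ℕ → Set where
  even : ∀ q → Parity (q + q)
  odd  : ∀ q → Parity (suc (q + q))

parity : ∀ k → Parity k
parity zero = even 0
parity (suc k) with parity k
... | even q = odd q
... | odd q = subst Parity (cong suc (+-suc q q)) (even (suc q))

quarterSquare-even : ∀ q → quarterSquare (q + q) ≡ q * q
quarterSquare-even zero = refl
quarterSquare-even (suc q) rewrite +-suc q q | quarterSquare-even q = step q
  where
  step : ∀ q → q * q + suc (q + q) ≡ suc q * suc q
  step = solve-∀

quarterSquare-odd : ∀ q → quarterSquare (suc (q + q)) ≡ q * suc q
quarterSquare-odd zero = refl
quarterSquare-odd (suc q) rewrite +-suc q q | quarterSquare-odd q = step q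
  where
  step : ∀ q → q * suc q + suc (suc (q + q)) ≡ suc q * suc (suc q)
  step = solve-∀

*≤quarterSquare[+] : ∀ a b → a * b ≤ quarterSquare (a + b)
*≤quarterSquare[+] zero b = z≤n
*≤quarterSquare[+] (suc a) zero = subst (_≤ quarterSquare (suc a + 0)) (sym (*-zeroʳ a)) z≤n
*≤quarterSquare[+] (suc a) (suc b) = begin
  suc a * suc b                          ≡⟨ expand a b ⟩
  a * b + suc (a + b)                    ≤⟨ +-monoˡ-≤ _ (*≤quarterSquare[+] a b) ⟩
  quarterSquare (a + b) + suc (a + b)    ≡⟨ cong (λ m → quarterSquare (suc m)) (+-suc a b) ⟨
  quarterSquare (suc a + suc b)          ∎
  where
  open ≤-Reasoning
  expand : ∀ a b → suc a * suc b ≡ a * b + suc (a + b)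
  expand = solve-∀

1≤quarterSquare⇒2≤ : ∀ {k} → 1 ≤ quarterSquare k → 2 ≤ k
1≤quarterSquare⇒2≤ {0} ()
1≤quarterSquare⇒2≤ {1} ()
1≤quarterSquare⇒2≤ {suc (suc k)} _ = s≤s (s≤s z≤n)

quarterSquare-split : ∀ {k} → 2 ≤ k →
  ∃₂ λ a b → 1 ≤ a × 1 ≤ b × a + b ≡ k × a * b ≡ quarterSquare k
quarterSquare-split {k} 2≤k with parity k
... | even (suc q) = suc q , suc q , s≤s z≤n , s≤s z≤n , refl , sym (quarterSquare-even (suc q))
... | odd (suc q) = suc q , suc (suc q) , s≤s z≤n , s≤s z≤n , cong suc (+-suc q (suc q)) , sym (quarterSquare-odd (suc q))
... | even zero = contradiction 2≤k λ ()
... | odd zero = contradiction 2≤k λ { (s≤s ()) }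

quarterSquare-step : ∀ k → quarterSquare k ≤ quarterSquare (suc k)
quarterSquare-step zero = z≤n
quarterSquare-step (suc zero) = z≤n
quarterSquare-step (suc (suc k)) = +-mono-≤ (quarterSquare-step k) (n≤1+n (suc k))

quarterSquare-mono-≤ : ∀ {m n} → m ≤ n → quarterSquare m ≤ quarterSquare n
quarterSquare-mono-≤ {n = zero} z≤n = ≤-refl
quarterSquare-mono-≤ {m} {suc n} m≤1+n with m≤n⇒m<n∨m≡n m≤1+n
... | inj₁ m<1+n = ≤-trans (quarterSquare-mono-≤ (≤-pred m<1+n)) (quarterSquare-step n)
... | inj₂ refl = ≤-refl

quarterSquare-suc-< : ∀ k → quarterSquare (suc k) < quarterSquare (suc (suc k))
quarterSquare-suc-< zero = s≤s z≤n
quarterSquare-suc-< (suc k) = +-mono-≤-< (quarterSquare-step k) (n<1+n (suc k))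

quarterSquare-mono-< : ∀ {m n} → m < n → 2 ≤ n → quarterSquare m < quarterSquare n
quarterSquare-mono-< {n = suc (suc n)} (s≤s m≤1+n) _ =
  ≤-<-trans (quarterSquare-mono-≤ m≤1+n) (quarterSquare-suc-< n)
quarterSquare-mono-< {n = suc zero} _ (s≤s ())

n≤quarterSquare[s] : ∀ n → n ≤ quarterSquare (s n)
n≤quarterSquare[s] n with s-attained n
... | a , b , refl , s≡a+b = subst (λ k → a * b ≤ quarterSquare k) (sym s≡a+b) (*≤quarterSquare[+] a b)

s[quarterSquare] : ∀ {k} → 2 ≤ k → s (quarterSquare k) ≡ k
s[quarterSquare] {k} 2≤k with quarterSquare-split 2≤k
... | a , b , 1≤a , 1≤b , a+b≡k , a*b≡qk = ≤-antisym s≤k (≮⇒≥ s≮k)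
  where
  s≤k : s (quarterSquare k) ≤ k
  s≤k = subst₂ (λ n m → s n ≤ m) a*b≡qk a+b≡k (s[*]≤+ 1≤a 1≤b)
  s≮k : s (quarterSquare k) ≮ k
  s≮k s<k = <⇒≱ (quarterSquare-mono-< s<k 2≤k) (n≤quarterSquare[s] (quarterSquare k))

quarterSquare-ratio-step : ∀ x → quarterSquare x * suc x ≤ quarterSquare (suc x) * x
quarterSquare-ratio-step x with parity x
... | even q rewrite quarterSquare-even q | quarterSquare-odd q = m+o≡n⇒m≤n (q * q) (excess q)
  where
  excess : ∀ q → q * q * suc (q + q) + q * q ≡ q * suc q * (q + q)
  excess = solve-∀
... | odd q rewrite quarterSquare-even q | quarterSquare-odd q = m+o≡n⇒m≤n (suc q * suc q) (excess q)
  where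
  excess : ∀ q → q * suc q * suc (suc (q + q)) + suc q * suc q ≡ (q * q + suc (q + q)) * suc (q + q)
  excess = solve-∀

quarterSquare-ratio-mono : ∀ {x w} → 1 ≤ x → x ≤ w → quarterSquare x * w ≤ quarterSquare w * x
quarterSquare-ratio-mono {x} 1≤x x≤w = go (≤⇒≤′ x≤w)
  where
  go : ∀ {w} → x ≤′ w → quarterSquare x * w ≤ quarterSquare w * x
  go ≤′-refl = ≤-refl
  go (≤′-step {w} x≤′w) = *-cancelʳ-≤ _ _ w {{>-nonZero (≤-trans 1≤x (≤′⇒≤ x≤′w))}} (begin
    quarterSquare x * suc w * w          ≡⟨ swap (quarterSquare x) (suc w) w ⟩
    quarterSquare x * w * suc w          ≤⟨ *-monoˡ-≤ (suc w) (go x≤′w) ⟩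
    quarterSquare w * x * suc w          ≡⟨ swap (quarterSquare w) x (suc w) ⟩
    quarterSquare w * suc w * x          ≤⟨ *-monoˡ-≤ x (quarterSquare-ratio-step w) ⟩
    quarterSquare (suc w) * w * x        ≡⟨ swap (quarterSquare (suc w)) w x ⟩
    quarterSquare (suc w) * x * w        ∎)
    where
    open ≤-Reasoning
    swap : ∀ a b c → a * b * c ≡ a * c * b
    swap = solve-∀

quarterSquare-gap : ∀ {y} → 2 ≤ y → y * quarterSquare (suc y) < quarterSquare y * (2 + y) + y
quarterSquare-gap {y} 2≤y with parity y
... | even zero = contradiction 2≤y λ ()
... | odd zero = contradiction 2≤y λ { (s≤s ()) }
... | even (suc p) rewrite quarterSquare-even (suc p) | quarterSquare-odd (suc p) =
  m+o≡n⇒m≤n (suc (p + p)) (excess p)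
  where
  excess : ∀ p → suc ((suc p + suc p) * (suc p * suc (suc p))) + suc (p + p)
               ≡ suc p * suc p * (2 + (suc p + suc p)) + (suc p + suc p)
  excess = solve-∀
... | odd (suc p) rewrite quarterSquare-even (suc p) | quarterSquare-odd (suc p) =
  m+o≡n⇒m≤n p (excess p)
  where
  excess : ∀ p → suc (suc (suc p + suc p) * (suc p * suc p + suc (suc p + suc p))) + p
               ≡ suc p * suc (suc p) * (2 + suc (suc p + suc p)) + suc (suc p + suc p)
  excess = solve-∀

quarterSquare-bracket : ∀ {n} → 1 ≤ n → ∃ λ y → 2 ≤ y × quarterSquare y ≤ n × n < quarterSquare (suc y)
quarterSquare-bracket {suc zero} _ = 2 , s≤s (s≤s z≤n) , s≤s z≤n , s≤s (s≤s z≤n)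
quarterSquare-bracket {suc (suc n)} _ with quarterSquare-bracket {suc n} (s≤s z≤n)
... | y , 2≤y , qy≤n , n<qy+1 with m≤n⇒m<n∨m≡n n<qy+1
...   | inj₁ n+1<qy+1 = y , 2≤y , m≤n⇒m≤1+n qy≤n , n+1<qy+1
...   | inj₂ n+1≡qy+1 = suc y , m≤n⇒m≤1+n 2≤y , ≤-reflexive (sym n+1≡qy+1) ,
                         subst (_< quarterSquare (suc (suc y))) (sym n+1≡qy+1) (quarterSquare-suc-< y)

-- Almost-squares

-- Since s (quarterSquare (k ∸ 1)) ≡ k ∸ 1, for s n ≡ k this says F n ≥ F (quarterSquare (k ∸ 1)).
FlockBound : ℕ → ℕ → Set
FlockBound k n = k * quarterSquare (k ∸ 1) ≤ n * (k ∸ 1)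

flockBound⇒F≤ : ∀ {n m} → FlockBound (s n) n → 1 ≤ m → m ≤ n → F≤ m n
flockBound⇒F≤ {n} {m} bound 1≤m m≤n with s n ≤? s m
... | yes sn≤sm = ≤-trans (*-monoˡ-≤ (s n) m≤n) (*-monoʳ-≤ n sn≤sm)
... | no sn≰sm = go (s n) (≰⇒> sn≰sm) bound
  where
  go : ∀ k → s m < k → FlockBound k n → m * k ≤ n * s m
  go (suc K) (s≤s sm≤K) bound = *-cancelʳ-≤ (m * suc K) (n * s m) K {{>-nonZero (≤-trans (<⇒≤ (s≥2 1≤m)) sm≤K)}} (begin
    m * suc K * K                     ≤⟨ *-monoˡ-≤ K (*-monoˡ-≤ (suc K) (n≤quarterSquare[s] m)) ⟩
    quarterSquare (s m) * suc K * K   ≡⟨ rearrange₁ (quarterSquare (s m)) (suc K) K ⟩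
    quarterSquare (s m) * K * suc K   ≤⟨ *-monoˡ-≤ (suc K) (quarterSquare-ratio-mono (<⇒≤ (s≥2 1≤m)) sm≤K) ⟩
    quarterSquare K * s m * suc K     ≡⟨ rearrange₂ (quarterSquare K) (s m) (suc K) ⟩
    suc K * quarterSquare K * s m     ≤⟨ *-monoˡ-≤ (s m) bound ⟩
    n * K * s m                       ≡⟨ rearrange₁ n K (s m) ⟩
    n * s m * K                       ∎)
    where
    open ≤-Reasoning
    rearrange₁ : ∀ a b c → a * b * c ≡ a * c * b
    rearrange₁ = solve-∀
    rearrange₂ : ∀ a b c → a * b * c ≡ c * a * b
    rearrange₂ = solve-∀

flockBound⇒almostSquare : ∀ {n} → 1 ≤ n → FlockBound (s n) n → AlmostSquare n
flockBound⇒almostSquare 1≤n bound = 1≤n , λ i → flockBound⇒F≤ bound (s≤s z≤n) (toℕ<n i)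

almostSquare-F≤ : ∀ {n m} → AlmostSquare n → 1 ≤ m → m ≤ n → F≤ m n
almostSquare-F≤ {n} {suc m} (_ , F≤n) _ m<n =
  subst (λ i → F≤ (suc i) n) (toℕ-fromℕ< m<n) (F≤n (fromℕ< m<n))

-- Otherwise quarterSquare y ≤ n < quarterSquare (y + 1) for some y < K, and s n ≥ y + 2 together
-- with quarterSquare-gap would give F n < F (quarterSquare y).
almostSquare⇒quarterSquare< : ∀ {n K} → AlmostSquare n → s n ≡ suc K → quarterSquare K < n
almostSquare⇒quarterSquare< {n} {K} as@(1≤n , _) sn≡1+K with quarterSquare K <? n
... | yes qK<n = qK<n
... | no qK≮n with quarterSquare-bracket 1≤n
...   | y , 2≤y , qy≤n , n<qy+1 = contradiction (quarterSquare-gap 2≤y) (≤⇒≯ (begin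
  quarterSquare y * (2 + y) + y   ≤⟨ +-monoˡ-≤ y (*-monoʳ-≤ (quarterSquare y) y+2≤sn) ⟩
  quarterSquare y * s n + y       ≤⟨ +-monoˡ-≤ y F[qy]≤F[n] ⟩
  n * y + y                       ≡⟨ +-comm (n * y) y ⟩
  suc n * y                       ≤⟨ *-monoˡ-≤ y n<qy+1 ⟩
  quarterSquare (suc y) * y       ≡⟨ *-comm (quarterSquare (suc y)) y ⟩
  y * quarterSquare (suc y)       ∎))
  where
  open ≤-Reasoning
  F[qy]≤F[n] : quarterSquare y * s n ≤ n * y
  F[qy]≤F[n] = subst (λ k → quarterSquare y * s n ≤ n * k) (s[quarterSquare] 2≤y)
                 (almostSquare-F≤ as (≤-trans (s≤s z≤n) (quarterSquare-mono-≤ 2≤y)) qy≤n)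
  y<K : y < K
  y<K with y <? K
  ... | yes y<K = y<K
  ... | no y≮K = contradiction (trans (sym sn≡1+K) (trans (cong s n≡qK) (s[quarterSquare] 2≤K))) (<⇒≢ (n<1+n K) ∘ sym)
    where
    n≡qK : n ≡ quarterSquare K
    n≡qK = ≤-antisym (≮⇒≥ qK≮n) (≤-trans (quarterSquare-mono-≤ (≮⇒≥ y≮K)) qy≤n)
    2≤K : 2 ≤ K
    2≤K = 1≤quarterSquare⇒2≤ (subst (1 ≤_) n≡qK 1≤n)
  y+2≤sn : 2 + y ≤ s n
  y+2≤sn = subst (2 + y ≤_) (sym sn≡1+K) (s≤s y<K)

almostSquare⇒flockBound : ∀ {n} → AlmostSquare n → FlockBound (s n) n
almostSquare⇒flockBound {n} as = go (s n) refl
  where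
  go : ∀ k → s n ≡ k → FlockBound k n
  go 0 _ = z≤n
  go 1 _ = z≤n
  go 2 _ = z≤n
  go (suc K@(suc (suc _))) sn≡1+K = begin
    suc K * quarterSquare K      ≡⟨ *-comm (suc K) (quarterSquare K) ⟩
    quarterSquare K * suc K      ≡⟨ cong (quarterSquare K *_) sn≡1+K ⟨
    quarterSquare K * s n        ≤⟨ almostSquare-F≤ as 1≤qK (<⇒≤ (almostSquare⇒quarterSquare< as sn≡1+K)) ⟩
    n * s (quarterSquare K)      ≡⟨ cong (n *_) (s[quarterSquare] (s≤s (s≤s z≤n))) ⟩
    n * K                        ∎
    where
    open ≤-Reasoning
    1≤qK : 1 ≤ quarterSquare K
    1≤qK = quarterSquare-mono-≤ {2} (s≤s (s≤s z≤n))

-- Flocks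

flockBound⇒quarterSquare< : ∀ {n K} → 1 ≤ n → FlockBound (suc K) n → quarterSquare K < n
flockBound⇒quarterSquare< {n} {K} 1≤n bound with quarterSquare K <? n
... | yes qK<n = qK<n
... | no qK≮n = contradiction (≤-trans n≤qK qK≤0) (<⇒≱ 1≤n)
  where
  open ≤-Reasoning
  n≤qK : n ≤ quarterSquare K
  n≤qK = ≮⇒≥ qK≮n
  qK≤0 : quarterSquare K ≤ 0
  qK≤0 = +-cancelʳ-≤ (K * quarterSquare K) (quarterSquare K) 0 (begin
    suc K * quarterSquare K    ≤⟨ bound ⟩
    n * K                      ≤⟨ *-monoˡ-≤ K n≤qK ⟩
    quarterSquare K * K        ≡⟨ *-comm (quarterSquare K) K ⟩
    K * quarterSquare K        ∎)

flockBound⇒≤s : ∀ {k n} → 1 ≤ n → FlockBound k n → k ≤ s n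
flockBound⇒≤s {zero} _ _ = z≤n
flockBound⇒≤s {suc K} {n} 1≤n bound with suc K ≤? s n
... | yes k≤sn = k≤sn
... | no k≰sn = contradiction (flockBound⇒quarterSquare< 1≤n bound)
  (≤⇒≯ (≤-trans (n≤quarterSquare[s] n) (quarterSquare-mono-≤ (≤-pred (≰⇒> k≰sn)))))

inFlock⇔ : ∀ {k n} → InFlock k n ⇔ (1 ≤ n × (∃₂ λ a b → a + b ≡ k × a * b ≡ n) × FlockBound k n)
inFlock⇔ {k} {n} = mk⇔ to from
  where
  to : InFlock k n → 1 ≤ n × (∃₂ λ a b → a + b ≡ k × a * b ≡ n) × FlockBound k n
  to (as@(1≤n , _) , refl) with s-attained n
  ... | a , b , a*b≡n , s≡a+b = 1≤n , (a , b , sym s≡a+b , a*b≡n) , almostSquare⇒flockBound as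
  from : 1 ≤ n × (∃₂ λ a b → a + b ≡ k × a * b ≡ n) × FlockBound k n → InFlock k n
  from (1≤n , (a , b , refl , refl) , bound) =
    flockBound⇒almostSquare 1≤n (subst (λ k → FlockBound k n) (sym s≡k) bound) , s≡k
    where
    s≡k : s (a * b) ≡ a + b
    s≡k = ≤-antisym (s[*]≤+ (proj₁ (1≤*⇒1≤ {a} {b} 1≤n)) (proj₂ (1≤*⇒1≤ {a} {b} 1≤n))) (flockBound⇒≤s 1≤n bound)

inFlock⇒quarterSquare< : ∀ {K n} → InFlock (suc K) n → quarterSquare K < n
inFlock⇒quarterSquare< inFlock with Equivalence.to inFlock⇔ inFlock
... | 1≤n , _ , bound = flockBound⇒quarterSquare< 1≤n bound

inFlock⇒≤quarterSquare : ∀ {k n} → InFlock k n → n ≤ quarterSquare k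
inFlock⇒≤quarterSquare {n = n} (_ , refl) = n≤quarterSquare[s] n

inFlock-order : ∀ {k k′ n m} → InFlock k n → InFlock k′ m → k < k′ → n < m
inFlock-order {k′ = suc K} n∈k m∈k′ (s≤s k≤K) =
  ≤-<-trans (≤-trans (inFlock⇒≤quarterSquare n∈k) (quarterSquare-mono-≤ k≤K)) (inFlock⇒quarterSquare< m∈k′)

quarterSquare-inFlock : ∀ {k} → 2 ≤ k → InFlock k (quarterSquare k)
quarterSquare-inFlock {suc K} 2≤k with quarterSquare-split 2≤k
... | a , b , _ , _ , a+b≡k , a*b≡qk = Equivalence.from inFlock⇔
  ( quarterSquare-mono-≤ 2≤k
  , (a , b , a+b≡k , a*b≡qk)
  , subst (_≤ quarterSquare (suc K) * K) (*-comm (quarterSquare K) (suc K)) (quarterSquare-ratio-step K))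

double-injective : ∀ {x y} → x + x ≡ y + y → x ≡ y
double-injective {x} {y} eq = trans (n≡⌊n+n/2⌋ x) (trans (cong ⌊_/2⌋ eq) (sym (n≡⌊n+n/2⌋ y)))

x+x≢1+y+y : ∀ x y → x + x ≢ suc (y + y)
x+x≢1+y+y x y eq = even≢odd x y (trans (cong (x +_) (+-identityʳ x)) (trans eq (cong (λ m → suc (y + m)) (sym (+-identityʳ y)))))

sorted-factors : ∀ {k n} → (∃₂ λ a b → a + b ≡ k × a * b ≡ n) →
  ∃₂ λ a b → a ≤ b × a + b ≡ k × a * b ≡ n
sorted-factors (a , b , a+b≡k , a*b≡n) with ≤-total a b
... | inj₁ a≤b = a , b , a≤b , a+b≡k , a*b≡n
... | inj₂ b≤a = b , a , b≤a , trans (+-comm b a) a+b≡k , trans (*-comm b a) a*b≡n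

odd-sum-product : ∀ {a b q} → a ≤ b → a + b ≡ suc (q + q) → ∃ λ i → a * b + i * suc i ≡ q * suc q
odd-sum-product {a} {q = q} a≤b a+b≡ with m≤n⇒∃[o]m+o≡n a≤b
... | d , refl with parity d
...   | even i = ⊥-elim (x+x≢1+y+y (a + i) q (trans (regroup a i) a+b≡))
  where
  regroup : ∀ a i → (a + i) + (a + i) ≡ a + (a + (i + i))
  regroup = solve-∀
...   | odd i = i , trans (complete a i) (cong (λ m → m * suc m) (double-injective {a + i} {q} (suc-injective (trans (regroup a i) a+b≡))))
  where
  regroup : ∀ a i → suc ((a + i) + (a + i)) ≡ a + (a + suc (i + i))
  regroup = solve-∀
  complete : ∀ a i → a * (a + suc (i + i)) + i * suc i ≡ (a + i) * suc (a + i)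
  complete = solve-∀

even-sum-product : ∀ {a b q} → 1 ≤ a → a ≤ b → a + b ≡ suc q + suc q →
  ∃ λ i → i ≤ q × a * b + i * i ≡ suc q * suc q
even-sum-product {suc a} {q = q} _ a≤b a+b≡ with m≤n⇒∃[o]m+o≡n a≤b
... | d , refl with parity d
...   | odd i = ⊥-elim (x+x≢1+y+y (suc q) (suc a + i) (trans (sym a+b≡) (regroup a i)))
  where
  regroup : ∀ a i → suc a + (suc a + suc (i + i)) ≡ suc ((suc a + i) + (suc a + i))
  regroup = solve-∀
...   | even i = i , ≤-pred (subst (suc i ≤_) a+i≡q (s≤s (m≤n+m i a))) , trans (complete a i) (cong (λ m → m * m) a+i≡q)
  where
  regroup : ∀ a i → (suc a + i) + (suc a + i) ≡ suc a + (suc a + (i + i))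
  regroup = solve-∀
  complete : ∀ a i → suc a * (suc a + (i + i)) + i * i ≡ (suc a + i) * (suc a + i)
  complete = solve-∀
  a+i≡q : suc a + i ≡ suc q
  a+i≡q = double-injective (trans (regroup a i) a+b≡)

≤-exchange : ∀ {a b c d} → a + c ≡ b + d → a ≤ b ⇔ d ≤ c
≤-exchange {a} {b} {c} {d} eq = mk⇔
  (λ a≤b → +-cancelˡ-≤ b d c (≤-trans (≤-reflexive (sym eq)) (+-monoˡ-≤ c a≤b)))
  (λ d≤c → +-cancelʳ-≤ c a b (≤-trans (≤-reflexive eq) (+-monoʳ-≤ b d≤c)))

≡-exchange : ∀ {a b c d} → a + c ≡ b + d → a ≡ b ⇔ d ≡ c
≡-exchange {a} {b} {c} {d} eq = mk⇔
  (λ { refl → sym (+-cancelˡ-≡ a c d eq) })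
  (λ { refl → +-cancelʳ-≡ c a b eq })

oddFlock-balance : ∀ q n i → n + i * suc i ≡ q * suc q →
  suc (q + q) * quarterSquare (q + q) + q * q ≡ n * (q + q) + q * (i * suc i + i * suc i)
oddFlock-balance q n i eq = begin
  suc (q + q) * quarterSquare (q + q) + q * q   ≡⟨ cong (λ m → suc (q + q) * m + q * q) (quarterSquare-even q) ⟩
  suc (q + q) * (q * q) + q * q                 ≡⟨ expand q ⟩
  (q + q) * (q * suc q)                         ≡⟨ cong ((q + q) *_) eq ⟨
  (q + q) * (n + i * suc i)                     ≡⟨ distribute q n (i * suc i) ⟩
  n * (q + q) + q * (i * suc i + i * suc i)     ∎
  where
  open ≡-Reasoning
  expand : ∀ q → suc (q + q) * (q * q) + q * q ≡ (q + q) * (q * suc q)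
  expand = solve-∀
  distribute : ∀ q n x → (q + q) * (n + x) ≡ n * (q + q) + q * (x + x)
  distribute = solve-∀

evenFlock-balance : ∀ q n i → n + i * i ≡ suc q * suc q →
  suc (suc (q + q)) * quarterSquare (suc (q + q)) + suc q * suc q ≡ n * suc (q + q) + suc (q + q) * (i * i)
evenFlock-balance q n i eq = begin
  suc (suc (q + q)) * quarterSquare (suc (q + q)) + suc q * suc q   ≡⟨ cong (λ m → suc (suc (q + q)) * m + suc q * suc q) (quarterSquare-odd q) ⟩
  suc (suc (q + q)) * (q * suc q) + suc q * suc q                   ≡⟨ expand q ⟩
  suc (q + q) * (suc q * suc q)                                     ≡⟨ cong (suc (q + q) *_) eq ⟨
  suc (q + q) * (n + i * i)                                         ≡⟨ distribute q n (i * i) ⟩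
  n * suc (q + q) + suc (q + q) * (i * i)                           ∎
  where
  open ≡-Reasoning
  expand : ∀ q → suc (suc (q + q)) * (q * suc q) + suc q * suc q ≡ suc (q + q) * (suc q * suc q)
  expand = solve-∀
  distribute : ∀ q n x → suc (q + q) * (n + x) ≡ n * suc (q + q) + suc (q + q) * x
  distribute = solve-∀

oddFlockBound⇔ : ∀ q n i → 1 ≤ q → n + i * suc i ≡ q * suc q → FlockBound (suc (q + q)) n ⇔ i * suc i + i * suc i ≤ q
oddFlockBound⇔ q@(suc _) n i 1≤q eq = mk⇔
  (*-cancelˡ-≤ q ∘ Equivalence.to (≤-exchange (oddFlock-balance q n i eq)))
  (Equivalence.from (≤-exchange (oddFlock-balance q n i eq)) ∘ *-monoʳ-≤ q)

oddFlockBound-≡⇔ : ∀ q n i → 1 ≤ q → n + i * suc i ≡ q * suc q →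
  suc (q + q) * quarterSquare (q + q) ≡ n * (q + q) ⇔ i * suc i + i * suc i ≡ q
oddFlockBound-≡⇔ q@(suc _) n i 1≤q eq = mk⇔
  (λ tight → *-cancelˡ-≡ _ q q (Equivalence.to (≡-exchange (oddFlock-balance q n i eq)) tight))
  (λ fits-exactly → Equivalence.from (≡-exchange (oddFlock-balance q n i eq)) (cong (q *_) fits-exactly))

[1+2q]*w≡[1+q]²⇒q≡0 : ∀ {q w} → suc (q + q) * w ≡ suc q * suc q → q ≡ 0
[1+2q]*w≡[1+q]²⇒q≡0 {q} {w} eq =
  m+n≡0⇒m≡0 q (suc-injective (∣1⇒≡1 (∣m+n∣m⇒∣n odd∣sum (m∣m*n (suc (suc (suc (q + q))))))))
  where
  open ≡-Reasoning
  -- (2q+2)² = (2q+1)(2q+3) + 1, so 2q + 1 divides 1.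
  odd∣sum : suc (q + q) ∣ suc (q + q) * suc (suc (suc (q + q))) + 1
  odd∣sum = divides (4 * w) (begin
    suc (q + q) * suc (suc (suc (q + q))) + 1   ≡⟨ square q ⟩
    4 * (suc q * suc q)                         ≡⟨ cong (4 *_) eq ⟨
    4 * (suc (q + q) * w)                       ≡⟨ reorder (suc (q + q)) w ⟩
    4 * w * suc (q + q)                         ∎)
    where
    square : ∀ q → suc (q + q) * suc (suc (suc (q + q))) + 1 ≡ 4 * (suc q * suc q)
    square = solve-∀
    reorder : ∀ d w → 4 * (d * w) ≡ 4 * w * d
    reorder = solve-∀

[1+2q]*i²≢[1+q]² : ∀ {q i} → i ≤ q → suc (q + q) * (i * i) ≢ suc q * suc q
[1+2q]*i²≢[1+q]² {q} {i} i≤q eq with [1+2q]*w≡[1+q]²⇒q≡0 {q} {i * i} eq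
... | refl with i≤q
...   | z≤n = contradiction eq λ ()

evenFlockBound-≢ : ∀ q n i → i ≤ q → n + i * i ≡ suc q * suc q →
  suc (suc (q + q)) * quarterSquare (suc (q + q)) ≢ n * suc (q + q)
evenFlockBound-≢ q n i i≤q eq = [1+2q]*i²≢[1+q]² i≤q ∘ Equivalence.to (≡-exchange (evenFlock-balance q n i eq))

i*i+i*i≤1+q⇒i≤q : ∀ {q} i → i * i + i * i ≤ suc q → i ≤ q
i*i+i*i≤1+q⇒i≤q zero _ = z≤n
i*i+i*i≤1+q⇒i≤q (suc i) fits = ≤-pred (≤-trans (m+o≡n⇒m≤n (2 * (i * i) + 3 * i) (excess i)) fits)
  where
  excess : ∀ i → suc (suc i) + (2 * (i * i) + 3 * i) ≡ suc i * suc i + suc i * suc i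
  excess = solve-∀

[1+2q]*i²≤[1+q]²⇒ : ∀ {q i} → i ≤ q → suc (q + q) * (i * i) ≤ suc q * suc q → i * i + i * i ≤ suc q
[1+2q]*i²≤[1+q]²⇒ {q} {i} i≤q bound with i * i + i * i ≤? suc q
... | yes fits = fits
... | no too-big = contradiction (subst (λ i → i * i + i * i ≤ suc q) (sym i≡0) z≤n) too-big
  where
  open ≤-Reasoning
  q≤0 : q ≤ 0
  q≤0 = +-cancelˡ-≤ (2 * (suc q * suc q)) q 0 (begin
    2 * (suc q * suc q) + q          ≡⟨ expand q ⟩
    suc (q + q) * suc (suc q)        ≤⟨ *-monoʳ-≤ (suc (q + q)) (≰⇒> too-big) ⟩
    suc (q + q) * (i * i + i * i)    ≡⟨ double (suc (q + q)) (i * i) ⟩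
    2 * (suc (q + q) * (i * i))      ≤⟨ *-monoʳ-≤ 2 bound ⟩
    2 * (suc q * suc q)              ≡⟨ +-identityʳ _ ⟨
    2 * (suc q * suc q) + 0          ∎)
    where
    expand : ∀ q → 2 * (suc q * suc q) + q ≡ suc (q + q) * suc (suc q)
    expand = solve-∀
    double : ∀ a w → a * (w + w) ≡ 2 * (a * w)
    double = solve-∀
  i≡0 : i ≡ 0
  i≡0 = n≤0⇒n≡0 (≤-trans i≤q q≤0)

[1+2q]*i²≤[1+q]²⇐ : ∀ {q i} → i * i + i * i ≤ suc q → suc (q + q) * (i * i) ≤ suc q * suc q
[1+2q]*i²≤[1+q]²⇐ {q} {i} fits = *-cancelˡ-≤ 2 (begin
  2 * (suc (q + q) * (i * i))             ≡⟨ double (suc (q + q)) (i * i) ⟩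
  suc (q + q) * (i * i + i * i)           ≤⟨ *-monoʳ-≤ (suc (q + q)) fits ⟩
  suc (q + q) * suc q                     ≤⟨ m≤m+n _ (suc q) ⟩
  suc (q + q) * suc q + suc q             ≡⟨ expand q ⟩
  2 * (suc q * suc q)                     ∎)
  where
  open ≤-Reasoning
  double : ∀ a w → 2 * (a * w) ≡ a * (w + w)
  double = solve-∀
  expand : ∀ q → suc (q + q) * suc q + suc q ≡ 2 * (suc q * suc q)
  expand = solve-∀

evenFlockBound⇔ : ∀ q n i → i ≤ q → n + i * i ≡ suc q * suc q →
  FlockBound (suc (suc (q + q))) n ⇔ i * i + i * i ≤ suc q
evenFlockBound⇔ q n i i≤q eq = mk⇔
  ([1+2q]*i²≤[1+q]²⇒ i≤q ∘ Equivalence.to (≤-exchange (evenFlock-balance q n i eq)))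
  (Equivalence.from (≤-exchange (evenFlock-balance q n i eq)) ∘ [1+2q]*i²≤[1+q]²⇐ {q} {i})

-- For n = a * b with a + b = k and a ≤ b, the index is i = ⌊(b − a)/2⌋, the half-width is
-- h = ⌊k/2⌋, and f i = i(i+1) or i² according to the parity of k.
FlockIndexing : ℕ → (ℕ → ℕ) → ℕ → Set
FlockIndexing k f h = ∀ {n} → InFlock k n ⇔ ∃ λ i → f i + f i ≤ h × n + f i ≡ f h

flockIndexing-cong : ∀ {k k′ f h} → k ≡ k′ → FlockIndexing k f h → FlockIndexing k′ f h
flockIndexing-cong refl indexing = indexing

oddIndex⇒< : ∀ {q} i → 1 ≤ q → i * suc i + i * suc i ≤ q → i < q
oddIndex⇒< zero 1≤q _ = 1≤q
oddIndex⇒< (suc i) _ index = ≤-trans (m+o≡n⇒m≤n (2 * (i * i) + 5 * i + 2) (excess i)) index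
  where
  excess : ∀ i → suc (suc i) + (2 * (i * i) + 5 * i + 2) ≡ suc i * suc (suc i) + suc i * suc (suc i)
  excess = solve-∀

oddFlockIndexing : ∀ {q} → 1 ≤ q → FlockIndexing (suc (q + q)) (λ i → i * suc i) q
oddFlockIndexing {q} 1≤q {n} = mk⇔ to from
  where
  to : InFlock (suc (q + q)) n → ∃ λ i → i * suc i + i * suc i ≤ q × n + i * suc i ≡ q * suc q
  to n∈flock with Equivalence.to inFlock⇔ n∈flock
  ... | 1≤n , factors , bound with sorted-factors factors
  ...   | a , b , a≤b , a+b≡k , refl with odd-sum-product {q = q} a≤b a+b≡k
  ...     | i , eq = i , Equivalence.to (oddFlockBound⇔ q (a * b) i 1≤q eq) bound , eq
  from : (∃ λ i → i * suc i + i * suc i ≤ q × n + i * suc i ≡ q * suc q) → InFlock (suc (q + q)) n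
  from (i , index , eq) with m≤n⇒∃[o]m+o≡n (oddIndex⇒< i 1≤q index)
  ... | c , refl = Equivalence.from inFlock⇔
    ( subst (1 ≤_) product (s≤s z≤n) , (suc c , suc c + suc (i + i) , sum i c , product)
    , Equivalence.from (oddFlockBound⇔ (suc i + c) n i 1≤q eq) index)
    where
    sum : ∀ i c → suc c + (suc c + suc (i + i)) ≡ suc ((suc i + c) + (suc i + c))
    sum = solve-∀
    complete : ∀ i c → suc c * (suc c + suc (i + i)) + i * suc i ≡ (suc i + c) * suc (suc i + c)
    complete = solve-∀
    product : suc c * (suc c + suc (i + i)) ≡ n
    product = +-cancelʳ-≡ (i * suc i) _ _ (trans (complete i c) (sym eq))

evenFlockIndexing-suc : ∀ {q} → FlockIndexing (suc (suc (q + q))) (λ i → i * i) (suc q)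
evenFlockIndexing-suc {q} {n} = mk⇔ to from
  where
  to : InFlock (suc (suc (q + q))) n → ∃ λ i → i * i + i * i ≤ suc q × n + i * i ≡ suc q * suc q
  to n∈flock with Equivalence.to inFlock⇔ n∈flock
  ... | 1≤n , factors , bound with sorted-factors factors
  ...   | a , b , a≤b , a+b≡k , refl
    with even-sum-product {q = q} (proj₁ (1≤*⇒1≤ {a} {b} 1≤n)) a≤b (trans a+b≡k (cong suc (sym (+-suc q q))))
  ...     | i , i≤q , eq = i , Equivalence.to (evenFlockBound⇔ q (a * b) i i≤q eq) bound , eq
  from : (∃ λ i → i * i + i * i ≤ suc q × n + i * i ≡ suc q * suc q) → InFlock (suc (suc (q + q))) n
  from (i , index , eq) with m≤n⇒∃[o]m+o≡n (i*i+i*i≤1+q⇒i≤q i index)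
  ... | c , refl = Equivalence.from inFlock⇔
    ( subst (1 ≤_) product (s≤s z≤n) , (suc c , suc c + (i + i) , sum i c , product)
    , Equivalence.from (evenFlockBound⇔ (i + c) n i (m≤m+n i c) eq) index)
    where
    sum : ∀ i c → suc c + (suc c + (i + i)) ≡ suc (suc ((i + c) + (i + c)))
    sum = solve-∀
    complete : ∀ i c → suc c * (suc c + (i + i)) + i * i ≡ suc (i + c) * suc (i + c)
    complete = solve-∀
    product : suc c * (suc c + (i + i)) ≡ n
    product = +-cancelʳ-≡ (i * i) _ _ (trans (complete i c) (sym eq))

evenFlockIndexing : ∀ {h} → 1 ≤ h → FlockIndexing (h + h) (λ i → i * i) h
evenFlockIndexing {suc q} _ = flockIndexing-cong (cong suc (sym (+-suc q q))) evenFlockIndexing-suc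

-- Counting

unique-⇔⇒length≡ : ∀ {xs ys : List ℕ} → Unique xs → Unique ys → (∀ {x} → x ∈ xs ⇔ x ∈ ys) → length xs ≡ length ys
unique-⇔⇒length≡ xs! ys! same = ↭-length (∼bag⇒↭ (unique∧set⇒bag xs! ys! same))

unique-map-injectiveOn : ∀ {xs : List ℕ} (f : ℕ → ℕ) → (∀ {x y} → x ∈ xs → y ∈ xs → f x ≡ f y → x ≡ y) →
  Unique xs → Unique (map f xs)
unique-map-injectiveOn f inj [] = []
unique-map-injectiveOn f inj (x∉xs ∷ xs!) =
  All.map⁺ (All.tabulate λ y∈xs fx≡fy → All.lookup x∉xs y∈xs (inj (here refl) (there y∈xs) fx≡fy))
  ∷ unique-map-injectiveOn f (λ x∈xs y∈xs → inj (there x∈xs) (there y∈xs)) xs!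

module _ {P : ℕ → Set} (P? : Decidable P) where

  filter-upTo-unique : ∀ N → Unique (filter P? (upTo N))
  filter-upTo-unique N = Unique.filter⁺ P? (Unique.upTo⁺ N)

  ∈-filter-upTo⇔ : ∀ N {x} → x ∈ filter P? (upTo N) ⇔ (x < N × P x)
  ∈-filter-upTo⇔ N = mk⇔
    (λ x∈ → let x∈upTo , Px = ∈-filter⁻ P? {xs = upTo N} x∈ in ∈-upTo⁻ x∈upTo , Px)
    (λ (x<N , Px) → ∈-filter⁺ P? (∈-upTo⁺ x<N) Px)

length-filter-upTo-image : ∀ {P C : ℕ → Set} (P? : Decidable P) (C? : Decidable C) (g : ℕ → ℕ) {N B} →
  (∀ {i j} → C i → C j → g i ≡ g j → i ≡ j) →
  (∀ {n} → P n ⇔ ∃ λ i → C i × n ≡ g i) →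
  (∀ {i} → C i → i < B × g i < N) →
  length (filter P? (upTo N)) ≡ length (filter C? (upTo B))
length-filter-upTo-image {P} {C} P? C? g {N} {B} inj image bounds = trans
  (unique-⇔⇒length≡ (filter-upTo-unique P? N) (unique-map-injectiveOn g injOn (filter-upTo-unique C? B)) same)
  (length-map g (filter C? (upTo B)))
  where
  injOn : ∀ {i j} → i ∈ filter C? (upTo B) → j ∈ filter C? (upTo B) → g i ≡ g j → i ≡ j
  injOn i∈ j∈ = inj (proj₂ (Equivalence.to (∈-filter-upTo⇔ C? B) i∈)) (proj₂ (Equivalence.to (∈-filter-upTo⇔ C? B) j∈))
  same : ∀ {n} → n ∈ filter P? (upTo N) ⇔ n ∈ map g (filter C? (upTo B))
  same = mk⇔
    (λ n∈ → let i , Ci , n≡gi = Equivalence.to image (proj₂ (Equivalence.to (∈-filter-upTo⇔ P? N) n∈))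
            in subst (_∈ _) (sym n≡gi) (∈-map⁺ g (Equivalence.from (∈-filter-upTo⇔ C? B) (proj₁ (bounds Ci) , Ci))))
    (λ n∈ → let i , i∈ , n≡gi = ∈-map⁻ g n∈
                Ci = proj₂ (Equivalence.to (∈-filter-upTo⇔ C? B) i∈)
            in Equivalence.from (∈-filter-upTo⇔ P? N)
                 (subst (_< N) (sym n≡gi) (proj₂ (bounds Ci)) , Equivalence.from image (i , Ci , n≡gi)))

length-filter-upTo-grows⇔ : ∀ {C C′ New : ℕ → Set} (C? : Decidable C) (C′? : Decidable C′) (New? : Decidable New) B →
  (∀ {i} → C′ i ⇔ (C i ⊎ New i)) → (∀ {i} → New i → ¬ C i) →
  (∀ {i j} → New i → New j → i ≡ j) → (∀ {i} → New i → i < B) →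
  length (filter C? (upTo B)) < length (filter C′? (upTo B)) ⇔ ∃ New
length-filter-upTo-grows⇔ {C} {C′} {New} C? C′? New? B split new⇒¬C new-unique new<B = mk⇔ grows⇒new new⇒grows
  where
  new⇒grows : ∃ New → length (filter C? (upTo B)) < length (filter C′? (upTo B))
  new⇒grows (i₀ , new) = ≤-reflexive (sym (unique-⇔⇒length≡ (filter-upTo-unique C′? B) i₀∷C! same))
    where
    i₀∷C! : Unique (i₀ ∷ filter C? (upTo B))
    i₀∷C! = All.tabulate (λ i∈ → λ { refl → new⇒¬C new (proj₂ (Equivalence.to (∈-filter-upTo⇔ C? B) i∈)) })
            ∷ filter-upTo-unique C? B
    same : ∀ {i} → i ∈ filter C′? (upTo B) ⇔ i ∈ i₀ ∷ filter C? (upTo B)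
    same = mk⇔
      (λ i∈ → let i<B , C′i = Equivalence.to (∈-filter-upTo⇔ C′? B) i∈ in
        [ (λ Ci → there (Equivalence.from (∈-filter-upTo⇔ C? B) (i<B , Ci))) , (λ newi → here (new-unique newi new)) ]
          (Equivalence.to split C′i))
      (λ { (here refl) → Equivalence.from (∈-filter-upTo⇔ C′? B) (new<B new , Equivalence.from split (inj₂ new))
         ; (there i∈) → let i<B , Ci = Equivalence.to (∈-filter-upTo⇔ C? B) i∈ in
             Equivalence.from (∈-filter-upTo⇔ C′? B) (i<B , Equivalence.from split (inj₁ Ci)) })
  grows⇒new : length (filter C? (upTo B)) < length (filter C′? (upTo B)) → ∃ New
  grows⇒new grows with anyUpTo? New? B
  ... | yes (i , _ , new) = i , new
  ... | no ¬new = contradiction (unique-⇔⇒length≡ (filter-upTo-unique C? B) (filter-upTo-unique C′? B) same) (<⇒≢ grows)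
    where
    same : ∀ {i} → i ∈ filter C? (upTo B) ⇔ i ∈ filter C′? (upTo B)
    same {i} = mk⇔
      (λ i∈ → let i<B , Ci = Equivalence.to (∈-filter-upTo⇔ C? B) i∈ in
        Equivalence.from (∈-filter-upTo⇔ C′? B) (i<B , Equivalence.from split (inj₁ Ci)))
      (λ i∈ → let i<B , C′i = Equivalence.to (∈-filter-upTo⇔ C′? B) i∈ in
        Equivalence.from (∈-filter-upTo⇔ C? B)
          (i<B , [ (λ Ci → Ci) , (λ newi → contradiction (i , i<B , newi) ¬new) ] (Equivalence.to split C′i)))

inFlock⇒≤square : ∀ {k n} → InFlock k n → n ≤ k * k
inFlock⇒≤square {n = n} (_ , refl) with s-attained n
... | a , b , refl , s≡a+b = subst (λ k → a * b ≤ k * k) (sym s≡a+b) (*-mono-≤ (m≤m+n a b) (m≤n+m b a))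

strictMono⇒injective : ∀ {a ℓ} {A : Set a} {_≺_ : A → A → Set ℓ} → Trichotomous _≡_ _≺_ →
  ∀ {f : A → ℕ} → (∀ {i j} → i ≺ j → f i < f j) → ∀ {i j} → f i ≡ f j → i ≡ j
strictMono⇒injective compare mono {i} {j} fi≡fj with compare i j
... | tri< i<j _ _ = contradiction fi≡fj (<⇒≢ (mono i<j))
... | tri≈ _ i≡j _ = i≡j
... | tri> _ _ j<i = contradiction (sym fi≡fj) (<⇒≢ (mono j<i))

double-≤⇒≤ : ∀ {x y} → x + x ≤ y + y → x ≤ y
double-≤⇒≤ {x} {y} le = subst₂ _≤_ (sym (n≡⌊n+n/2⌋ x)) (sym (n≡⌊n+n/2⌋ y)) (⌊n/2⌋-mono le)

≤-suc⇔ : ∀ {m n} → m ≤ suc n ⇔ (m ≤ n ⊎ m ≡ suc n)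
≤-suc⇔ = mk⇔ (λ m≤1+n → [ inj₁ ∘ ≤-pred , inj₂ ] (m≤n⇒m<n∨m≡n m≤1+n)) [ m≤n⇒m≤1+n , ≤-reflexive ]

module _ {k f h} (indexing : FlockIndexing k f h) where

  private
    index≤ : ∀ {i} → f i + f i ≤ h → f i ≤ h
    index≤ {i} fits = ≤-trans (m≤m+n (f i) (f i)) fits

  flockSize-indexed : (∀ {i j} → i < j → f i < f j) → (∀ i → i ≤ f i) → ∀ {B} → h < B →
    flockSize k ≡ length (filter (λ i → f i + f i ≤? h) (upTo B))
  flockSize-indexed mono inflationary {B} h<B =
    length-filter-upTo-image (inFlock? k) (λ i → f i + f i ≤? h) (λ i → f h ∸ f i) inj image bounds
    where
    fi≤fh : ∀ {i} → f i + f i ≤ h → f i ≤ f h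
    fi≤fh fits = ≤-trans (index≤ fits) (inflationary h)
    inj : ∀ {i j} → f i + f i ≤ h → f j + f j ≤ h → f h ∸ f i ≡ f h ∸ f j → i ≡ j
    inj fits fits′ eq = strictMono⇒injective <-cmp mono (∸-cancelˡ-≡ (fi≤fh fits) (fi≤fh fits′) eq)
    image : ∀ {n} → InFlock k n ⇔ ∃ λ i → f i + f i ≤ h × n ≡ f h ∸ f i
    image {n} = mk⇔
      (λ n∈ → let i , fits , eq = Equivalence.to indexing n∈ in i , fits , trans (sym (m+n∸n≡m n (f i))) (cong (_∸ f i) eq))
      (λ { (i , fits , refl) → Equivalence.from indexing (i , fits , m∸n+n≡m (fi≤fh fits)) })
    bounds : ∀ {i} → f i + f i ≤ h → i < B × f h ∸ f i < suc (k * k)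
    bounds {i} fits = ≤-<-trans (≤-trans (inflationary i) (index≤ fits)) h<B
                    , s≤s (inFlock⇒≤square (Equivalence.from image (i , fits , refl)))

  flockIndexing-min : ∀ {n₀ i₀} → f i₀ + f i₀ ≡ h → n₀ + f i₀ ≡ f h → MinOfFlock k n₀
  flockIndexing-min {n₀} {i₀} tight eq = Equivalence.from indexing (i₀ , ≤-reflexive tight , eq) , above
    where
    above : ∀ m → InFlock k m → n₀ ≤ m
    above m m∈ with Equivalence.to indexing m∈
    ... | i , fits , eq′ =
      Equivalence.from (≤-exchange (trans eq (sym eq′))) (double-≤⇒≤ (≤-trans fits (≤-reflexive (sym tight))))

flockSize-grows⇔ : ∀ {k′ k f h} → FlockIndexing k′ f h → FlockIndexing k f (suc h) →
  (∀ {i j} → i < j → f i < f j) → (∀ i → i ≤ f i) →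
  flockSize k′ < flockSize k ⇔ ∃ λ i → f i + f i ≡ suc h
flockSize-grows⇔ {f = f} {h} indexing′ indexing mono inflationary =
  subst₂ (λ a b → a < b ⇔ ∃ λ i → f i + f i ≡ suc h)
    (sym (flockSize-indexed indexing′ mono inflationary (≤-trans (n<1+n h) (n≤1+n (suc h)))))
    (sym (flockSize-indexed indexing mono inflationary (n<1+n (suc h))))
    (length-filter-upTo-grows⇔ (λ i → f i + f i ≤? h) (λ i → f i + f i ≤? suc h) (λ i → f i + f i ≟ suc h) (suc (suc h))
      ≤-suc⇔ new⇒¬fits new-unique new<B)
  where
  new⇒¬fits : ∀ {i} → f i + f i ≡ suc h → f i + f i ≰ h
  new⇒¬fits new fits = 1+n≰n (subst (_≤ h) new fits)
  new-unique : ∀ {i j} → f i + f i ≡ suc h → f j + f j ≡ suc h → i ≡ j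
  new-unique new new′ = strictMono⇒injective <-cmp mono (double-injective (trans new (sym new′)))
  new<B : ∀ {i} → f i + f i ≡ suc h → i < suc (suc h)
  new<B {i} new = s≤s (≤-trans (inflationary i) (≤-trans (m≤m+n (f i) (f i)) (≤-reflexive new)))

oblong-strictMono : ∀ {i j} → i < j → i * suc i < j * suc j
oblong-strictMono i<j = *-mono-< i<j (s≤s i<j)

square-strictMono : ∀ {i j} → i < j → i * i < j * j
square-strictMono i<j = *-mono-< i<j i<j

i≤i*i : ∀ i → i ≤ i * i
i≤i*i zero = z≤n
i≤i*i (suc i) = m≤m*n (suc i) (suc i)

oddSquare : ∀ i → (i + i + 1) * (i + i + 1) ≡ suc ((i * suc i + i * suc i) + (i * suc i + i * suc i))
oddSquare = solve-∀

evenSquare : ∀ i → (suc (i + i) + 1) * (suc (i + i) + 1) ≡ (suc i * suc i + suc i * suc i) + (suc i * suc i + suc i * suc i)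
evenSquare = solve-∀

oddSquare⇔ : ∀ {h} → 1 ≤ h → (∃ λ i → i * suc i + i * suc i ≡ h) ⇔ (∃ λ j → 1 ≤ j × suc (h + h) ≡ (j + 1) * (j + 1))
oddSquare⇔ {h} 1≤h = mk⇔ to from
  where
  to : (∃ λ i → i * suc i + i * suc i ≡ h) → ∃ λ j → 1 ≤ j × suc (h + h) ≡ (j + 1) * (j + 1)
  to (zero , refl) = contradiction 1≤h λ ()
  to (suc i , refl) = suc i + suc i , s≤s z≤n , sym (oddSquare (suc i))
  from : (∃ λ j → 1 ≤ j × suc (h + h) ≡ (j + 1) * (j + 1)) → ∃ λ i → i * suc i + i * suc i ≡ h
  from (j , _ , eq) with parity j
  ... | even i = i , double-injective {i * suc i + i * suc i} {h} (suc-injective (trans (sym (oddSquare i)) (sym eq)))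
  ... | odd i = ⊥-elim (x+x≢1+y+y (suc i * suc i + suc i * suc i) h (trans (sym (evenSquare i)) (sym eq)))

evenSquare⇔ : ∀ {h} → 1 ≤ h → (∃ λ i → i * i + i * i ≡ h) ⇔ (∃ λ j → 1 ≤ j × h + h ≡ (j + 1) * (j + 1))
evenSquare⇔ {h} 1≤h = mk⇔ to from
  where
  to : (∃ λ i → i * i + i * i ≡ h) → ∃ λ j → 1 ≤ j × h + h ≡ (j + 1) * (j + 1)
  to (zero , refl) = contradiction 1≤h λ ()
  to (suc i , refl) = suc (i + i) , s≤s z≤n , sym (evenSquare i)
  from : (∃ λ j → 1 ≤ j × h + h ≡ (j + 1) * (j + 1)) → ∃ λ i → i * i + i * i ≡ h
  from (j , _ , eq) with parity j
  ... | even i = ⊥-elim (x+x≢1+y+y h (i * suc i + i * suc i) (trans eq (oddSquare i)))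
  ... | odd i = suc i , double-injective {suc i * suc i + suc i * suc i} {h} (trans (sym (evenSquare i)) (sym eq))

flockSize-grows⇔square : ∀ {k} → 4 ≤ k → flockSize (k ∸ 2) < flockSize k ⇔ ∃ λ j → 1 ≤ j × k ≡ (j + 1) * (j + 1)
flockSize-grows⇔square {k} 4≤k with parity k
... | even 0 = contradiction 4≤k λ ()
... | even 1 = contradiction 4≤k λ { (s≤s (s≤s ())) }
... | odd 0 = contradiction 4≤k λ { (s≤s ()) }
... | odd 1 = contradiction 4≤k λ { (s≤s (s≤s (s≤s ()))) }
... | even (suc (suc p)) = evenSquare⇔ (s≤s z≤n) ⇔-∘
  subst (λ k′ → flockSize k′ < flockSize k ⇔ ∃ λ i → i * i + i * i ≡ suc (suc p)) (sym (+-suc p (suc p)))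
    (flockSize-grows⇔ (evenFlockIndexing {suc p} (s≤s z≤n)) (evenFlockIndexing (s≤s z≤n)) square-strictMono i≤i*i)
... | odd (suc (suc p)) = oddSquare⇔ (s≤s z≤n) ⇔-∘
  subst (λ k′ → flockSize k′ < flockSize k ⇔ ∃ λ i → i * suc i + i * suc i ≡ suc (suc p)) (sym (cong suc (+-suc p (suc p))))
    (flockSize-grows⇔ (oddFlockIndexing {suc p} (s≤s z≤n)) (oddFlockIndexing (s≤s z≤n)) oblong-strictMono (λ i → m≤m*n i (suc i)))

-- Pioneers

pioneer : ℕ → ℕ
pioneer j = t (j + 1) * t (j + 2)

t[1+m] : ∀ m v → suc m * m ≡ v * 2 → t (suc m) ≡ v
t[1+m] m v eq = trans (cong (_/ 2) eq) (m*n/n≡m v 2)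

pioneer≡ : ∀ j → pioneer j ≡ t (suc j) * t (suc (suc j))
pioneer≡ j = cong₂ (λ a b → t a * t b) (+-comm j 1) (+-comm j 2)

pioneer-evenIndex : ∀ i → let h = i * suc i + i * suc i in pioneer (i + i) + i * suc i ≡ h * suc h
pioneer-evenIndex i = trans (cong (_+ i * suc i) (trans (pioneer≡ (i + i)) (cong₂ _*_ t₁ t₂))) (value i)
  where
  half₁ : ∀ i → suc (i + i) * (i + i) ≡ i * suc (i + i) * 2
  half₁ = solve-∀
  half₂ : ∀ i → suc (suc (i + i)) * suc (i + i) ≡ suc i * suc (i + i) * 2
  half₂ = solve-∀
  t₁ : t (suc (i + i)) ≡ i * suc (i + i)
  t₁ = t[1+m] (i + i) _ (half₁ i)
  t₂ : t (suc (suc (i + i))) ≡ suc i * suc (i + i)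
  t₂ = t[1+m] (suc (i + i)) _ (half₂ i)
  value : ∀ i → i * suc (i + i) * (suc i * suc (i + i)) + i * suc i ≡ (i * suc i + i * suc i) * suc (i * suc i + i * suc i)
  value = solve-∀

pioneer-oddIndex : ∀ i → let h = suc i * suc i + suc i * suc i in pioneer (suc (i + i)) + suc i * suc i ≡ h * h
pioneer-oddIndex i = trans (cong (_+ suc i * suc i) (trans (pioneer≡ (suc (i + i))) (cong₂ _*_ t₁ t₂))) (value i)
  where
  half₁ : ∀ i → suc (suc (i + i)) * suc (i + i) ≡ suc i * suc (i + i) * 2
  half₁ = solve-∀
  half₂ : ∀ i → suc (suc (suc (i + i))) * suc (suc (i + i)) ≡ suc (suc (suc (i + i))) * suc i * 2
  half₂ = solve-∀
  t₁ : t (suc (suc (i + i))) ≡ suc i * suc (i + i)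
  t₁ = t[1+m] (suc (i + i)) _ (half₁ i)
  t₂ : t (suc (suc (suc (i + i)))) ≡ suc (suc (suc (i + i))) * suc i
  t₂ = t[1+m] (suc (suc (i + i))) _ (half₂ i)
  value : ∀ i → suc i * suc (i + i) * (suc (suc (suc (i + i))) * suc i) + suc i * suc i
              ≡ (suc i * suc i + suc i * suc i) * (suc i * suc i + suc i * suc i)
  value = solve-∀

pioneer-flock : ∀ {j} → 1 ≤ j →
  ∃₂ λ f h → FlockIndexing ((j + 1) * (j + 1)) f h × ∃ λ i → f i + f i ≡ h × pioneer j + f i ≡ f h
pioneer-flock {j} 1≤j with parity j
... | even zero = contradiction 1≤j λ ()
... | even (suc i) =
  _ , _ , flockIndexing-cong (sym (oddSquare (suc i))) (oddFlockIndexing (s≤s z≤n)) , suc i , refl , pioneer-evenIndex (suc i)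
... | odd i =
  _ , _ , flockIndexing-cong (sym (evenSquare i)) (evenFlockIndexing (s≤s z≤n)) , suc i , refl , pioneer-oddIndex i

pioneer-minOfFlock : ∀ {j} → 1 ≤ j → MinOfFlock ((j + 1) * (j + 1)) (pioneer j)
pioneer-minOfFlock 1≤j with pioneer-flock 1≤j
... | _ , _ , indexing , _ , tight , value = flockIndexing-min indexing tight value

minOfFlock-unique : ∀ {k n m} → MinOfFlock k n → MinOfFlock k m → n ≡ m
minOfFlock-unique (n∈ , n≤) (m∈ , m≤) = ≤-antisym (n≤ _ m∈) (m≤ _ n∈)

4≤[1+j]² : ∀ {j} → 1 ≤ j → 4 ≤ (j + 1) * (j + 1)
4≤[1+j]² 1≤j = *-mono-≤ (+-monoˡ-≤ 1 1≤j) (+-monoˡ-≤ 1 1≤j)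

isPioneer⇔ : ∀ {n} → IsPioneer n ⇔ ∃ λ j → 1 ≤ j × n ≡ pioneer j
isPioneer⇔ {n} = mk⇔ to from
  where
  to : IsPioneer n → ∃ λ j → 1 ≤ j × n ≡ pioneer j
  to (k , 4≤k , min , grows) with Equivalence.to (flockSize-grows⇔square 4≤k) grows
  ... | j , 1≤j , refl = j , 1≤j , minOfFlock-unique min (pioneer-minOfFlock 1≤j)
  from : (∃ λ j → 1 ≤ j × n ≡ pioneer j) → IsPioneer n
  from (j , 1≤j , refl) = (j + 1) * (j + 1) , 4≤[1+j]² 1≤j , pioneer-minOfFlock 1≤j
                        , Equivalence.from (flockSize-grows⇔square (4≤[1+j]² 1≤j)) (j , 1≤j , refl)

pioneer-strictMono : ∀ {i j} → 1 ≤ i → i < j → pioneer i < pioneer j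
pioneer-strictMono 1≤i i<j = inFlock-order (proj₁ (pioneer-minOfFlock 1≤i)) (proj₁ (pioneer-minOfFlock (≤-trans 1≤i (<⇒≤ i<j))))
  (*-mono-< (+-monoˡ-< 1 i<j) (+-monoˡ-< 1 i<j))

pioneer-mono-≤ : ∀ {i j} → 1 ≤ i → i ≤ j → pioneer i ≤ pioneer j
pioneer-mono-≤ 1≤i i≤j with m≤n⇒m<n∨m≡n i≤j
... | inj₁ i<j = <⇒≤ (pioneer-strictMono 1≤i i<j)
... | inj₂ refl = ≤-refl

pioneer-cancel-≤ : ∀ {i j} → 1 ≤ j → pioneer i ≤ pioneer j → i ≤ j
pioneer-cancel-≤ {i} {j} 1≤j p≤p = ≮⇒≥ λ j<i → <⇒≱ (pioneer-strictMono 1≤j j<i) p≤p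

pioneer-jth : ∀ {j} → 1 ≤ j → JthPioneer j (pioneer j)
pioneer-jth {j} 1≤j =
  Equivalence.from isPioneer⇔ (j , 1≤j , refl) , enumerate
  , (λ a b a<b → pioneer-strictMono (s≤s z≤n) (s≤s a<b))
  , (λ a → Equivalence.from isPioneer⇔ (suc (toℕ a) , s≤s z≤n , refl))
  , (λ a → pioneer-mono-≤ (s≤s z≤n) (toℕ<n a))
  , complete
  where
  enumerate : Fin j → ℕ
  enumerate a = pioneer (suc (toℕ a))
  complete : ∀ m → IsPioneer m → m ≤ pioneer j → ∃ λ a → enumerate a ≡ m
  complete m m-pioneer m≤ with Equivalence.to isPioneer⇔ m-pioneer
  ... | suc j₀ , _ , refl = fromℕ< j₀<j , cong (pioneer ∘ suc) (toℕ-fromℕ< j₀<j)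
    where
    j₀<j : j₀ < j
    j₀<j = pioneer-cancel-≤ 1≤j m≤

jthPioneer-embedding : ∀ {j j′ n} → JthPioneer j n → JthPioneer j′ n → Σ (Fin j → Fin j′) (Injective _≡_ _≡_)
jthPioneer-embedding {j} {j′} (_ , f , f-mono , f-pioneer , f≤n , _) (_ , g , _ , _ , _ , g-complete) = index , index-injective
  where
  index : Fin j → Fin j′
  index a = proj₁ (g-complete (f a) (f-pioneer a) (f≤n a))
  index-injective : Injective _≡_ _≡_ index
  index-injective {a} {b} eq = strictMono⇒injective <ᶠ-cmp (λ {a} {b} → f-mono a b)
    (trans (sym (proj₂ (g-complete (f a) (f-pioneer a) (f≤n a)))) (trans (cong g eq) (proj₂ (g-complete (f b) (f-pioneer b) (f≤n b)))))

jthPioneer-unique : ∀ {j j′ n} → JthPioneer j n → JthPioneer j′ n → j ≡ j′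
jthPioneer-unique jth jth′ = cantor-schröder-bernstein (proj₂ (jthPioneer-embedding jth jth′)) (proj₂ (jthPioneer-embedding jth′ jth))

-- Ties between consecutive almost-squares

s≥3 : ∀ {n} → 1 < n → 3 ≤ s n
s≥3 {n} 1<n = ≤∧≢⇒< (s≥2 (<⇒≤ 1<n))
  λ 2≡sn → <⇒≱ 1<n (subst (λ k → n ≤ quarterSquare k) (sym 2≡sn) (n≤quarterSquare[s] n))

largestBelow-cases : ∀ {n n′ K} → AlmostSquare n → s n ≡ suc K → 2 ≤ K → LargestASBelow n n′ →
  n′ ≡ quarterSquare K ⊎ s n′ ≡ suc K
largestBelow-cases {n} {n′} {K} as sn≡1+K 2≤K (as′ , n′<n , largest) with <-cmp (s n′) (suc K)
... | tri< sn′≤K _ _ = inj₁ (≤-antisym (≤-trans (n≤quarterSquare[s] n′) (quarterSquare-mono-≤ (≤-pred sn′≤K))) qK≤n′)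
  where
  qK≤n′ : quarterSquare K ≤ n′
  qK≤n′ = largest (quarterSquare K) (proj₁ (quarterSquare-inFlock 2≤K)) (inFlock⇒quarterSquare< (as , sn≡1+K))
... | tri≈ _ sn′≡1+K _ = inj₂ sn′≡1+K
... | tri> _ _ 1+K<sn′ = contradiction (inFlock-order (as , sn≡1+K) (as′ , refl) 1+K<sn′) (<⇒≯ n′<n)

F≡[quarterSquare]⇔ : ∀ {n K} → s n ≡ suc K → 2 ≤ K → F≡ n (quarterSquare K) ⇔ suc K * quarterSquare K ≡ n * K
F≡[quarterSquare]⇔ {n} {K} sn≡1+K 2≤K
  rewrite s[quarterSquare] 2≤K | sn≡1+K | *-comm (quarterSquare K) (suc K) = mk⇔ sym sym

tight⇒evenPioneer : ∀ {n K} → InFlock (suc K) n → 2 ≤ K → suc K * quarterSquare K ≡ n * K →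
  ∃ λ j → 2 ∣ j × JthPioneer j n
tight⇒evenPioneer {n} {K} n∈flock 2≤K tight with parity K
... | even zero = contradiction 2≤K λ ()
... | even q@(suc _) with Equivalence.to (oddFlockIndexing (s≤s z≤n)) n∈flock
...   | zero , _ , eq = contradiction (Equivalence.to (oddFlockBound-≡⇔ q n 0 (s≤s z≤n) eq) tight) λ ()
...   | i@(suc _) , _ , eq = i + i , divides i (double i) , subst (JthPioneer (i + i)) (sym n≡pioneer) (pioneer-jth (s≤s z≤n))
  where
  double : ∀ i → i + i ≡ i * 2
  double = solve-∀
  h≡q : i * suc i + i * suc i ≡ q
  h≡q = Equivalence.to (oddFlockBound-≡⇔ q n i (s≤s z≤n) eq) tight
  n≡pioneer : n ≡ pioneer (i + i)
  n≡pioneer = +-cancelʳ-≡ (i * suc i) n (pioneer (i + i))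
    (trans eq (sym (subst (λ h → pioneer (i + i) + i * suc i ≡ h * suc h) h≡q (pioneer-evenIndex i))))
tight⇒evenPioneer {n} {K} n∈flock 2≤K tight | odd q with Equivalence.to evenFlockIndexing-suc n∈flock
... | i , fits , eq = contradiction tight (evenFlockBound-≢ q n i (i*i+i*i≤1+q⇒i≤q i fits) eq)

evenPioneer-tight : ∀ {K c} → 1 ≤ c → s (pioneer (c + c)) ≡ suc K → suc K * quarterSquare K ≡ pioneer (c + c) * K
evenPioneer-tight {K} {c@(suc _)} _ s≡1+K =
  subst (λ K → suc K * quarterSquare K ≡ pioneer (c + c) * K) h+h≡K
    (Equivalence.from (oddFlockBound-≡⇔ h (pioneer (c + c)) c (s≤s z≤n) (pioneer-evenIndex c)) refl)
  where
  h : ℕ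
  h = c * suc c + c * suc c
  h+h≡K : h + h ≡ K
  h+h≡K = suc-injective (trans (sym (oddSquare c)) (trans (sym (proj₂ (proj₁ (pioneer-minOfFlock {c + c} (s≤s z≤n))))) s≡1+K))

evenPioneer-F≡ : ∀ {n n′ K} → (∃ λ c → 1 ≤ c × n ≡ pioneer (c + c)) → s n ≡ suc K → 2 ≤ K →
  LargestASBelow n n′ → F≡ n n′
evenPioneer-F≡ {n} {n′} {K} (c@(suc _) , 1≤c , refl) sn≡1+K 2≤K largest@(as′ , n′<n , _)
  with pioneer-minOfFlock {c + c} (s≤s z≤n)
... | (as , sn≡k) , minimal with largestBelow-cases as sn≡1+K 2≤K largest
...   | inj₁ n′≡qK =
  subst (F≡ n) (sym n′≡qK) (Equivalence.from (F≡[quarterSquare]⇔ {n} sn≡1+K 2≤K) (evenPioneer-tight 1≤c sn≡1+K))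
...   | inj₂ sn′≡1+K = contradiction (minimal n′ (as′ , trans sn′≡1+K (trans (sym sn≡1+K) sn≡k))) (<⇒≱ n′<n)

evenJth⇒pioneer : ∀ {n} → (∃ λ j → 2 ∣ j × JthPioneer j n) → ∃ λ c → 1 ≤ c × n ≡ pioneer (c + c)
evenJth⇒pioneer {n} (j , divides c j≡c*2 , jth) with Equivalence.to isPioneer⇔ (proj₁ jth)
... | j₀ , 1≤j₀ , n≡pioneer = c , n≢0⇒n>0 c≢0 , trans n≡pioneer (cong pioneer j₀≡c+c)
  where
  double : ∀ c → c * 2 ≡ c + c
  double = solve-∀
  j₀≡c+c : j₀ ≡ c + c
  j₀≡c+c = trans (sym (jthPioneer-unique jth (subst (JthPioneer j₀) (sym n≡pioneer) (pioneer-jth 1≤j₀)))) (trans j≡c*2 (double c))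
  c≢0 : c ≢ 0
  c≢0 c≡0 = <⇒≱ 1≤j₀ (≤-reflexive (trans j₀≡c+c (cong (λ x → x + x) c≡0)))

F≡-largestBelow⇔ : ∀ {n n′} → AlmostSquare n → 1 < n → LargestASBelow n n′ →
  F≡ n n′ ⇔ ∃ λ j → 2 ∣ j × JthPioneer j n
F≡-largestBelow⇔ {n} {n′} as 1<n largest@(_ , n′<n , _) = mk⇔ fwd bwd
  where
  K : ℕ
  K = s n ∸ 1
  sn≡1+K : s n ≡ suc K
  sn≡1+K = sym (m+[n∸m]≡n (≤-trans (s≤s z≤n) (s≥3 1<n)))
  2≤K : 2 ≤ K
  2≤K = ≤-pred (subst (3 ≤_) sn≡1+K (s≥3 1<n))
  fwd : F≡ n n′ → ∃ λ j → 2 ∣ j × JthPioneer j n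
  fwd F with largestBelow-cases as sn≡1+K 2≤K largest
  ... | inj₁ n′≡qK =
    tight⇒evenPioneer (as , sn≡1+K) 2≤K (Equivalence.to (F≡[quarterSquare]⇔ {n} sn≡1+K 2≤K) (subst (F≡ n) n′≡qK F))
  ... | inj₂ sn′≡1+K =
    contradiction (*-cancelʳ-≡ n n′ (suc K) (subst₂ (λ a b → n * a ≡ n′ * b) sn′≡1+K sn≡1+K F)) (<⇒≢ n′<n ∘ sym)
  bwd : (∃ λ j → 2 ∣ j × JthPioneer j n) → F≡ n n′
  bwd evenJth = evenPioneer-F≡ (evenJth⇒pioneer evenJth) sn≡1+K 2≤K largest

corollary4 : ((j : ℕ) → 1 ≤ j →
                JthPioneer j (t (j + 1) * t (j + 2))
                × MinOfFlock ((j + 1) * (j + 1)) (t (j + 1) * t (j + 2)))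
           × ((n n' : ℕ) → AlmostSquare n → 1 < n → LargestASBelow n n' →
                (F≡ n n' ⇔ (∃ λ j → (2 ∣ j) × JthPioneer j n)))
corollary4 = (λ j 1≤j → pioneer-jth 1≤j , pioneer-minOfFlock 1≤j)
           , (λ n n′ as 1<n largest → F≡-largestBelow⇔ as 1<n largest)
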